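{- Let $G$ be a group and let $A, B, C$ be finite $G$-modules such that $G$ acts trivially on $A$ and on $C$ and $G$ acts faithfully on $B$. Let $0 \to A \to B \to C \to 0$ be an exact sequence of $G$-modules, and let $k$ be the number of generators of $C$. Then $G$ is finite and $\# G$ divides $(\# A)^k$. -}

module Defs where

open import Level using (Level; _⊔_)
open import Algebra.Bundles using (Group; AbelianGroup)
open import Data.Nat using (ℕ; zero; suc)
open import Data.Integer using (ℤ; +_; -[1+_])
open import Data.Fin using (Fin)
import Data.Fin as Fin
open import Data.Product using (Σ; ∃; _×_)
open import Function.Bundles using (Inverse)
open import Relation.Nullary using (¬_)
import Relation.Binary.PropositionalEquality as ≡

record GModule {g gℓ : Level} (G : Group g gℓ) (m mℓ : Level)
       : Set (Level.suc (m ⊔ mℓ) ⊔ g ⊔ gℓ) where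
  private module G = Group G
  field
    M : AbelianGroup m mℓ
  open AbelianGroup M public
  infixr 7 _·_
  field
    _·_      : G.Carrier → Carrier → Carrier
    ·-cong   : ∀ {g h x y} → g G.≈ h → x ≈ y → (g · x) ≈ (h · y)
    ·-ident  : ∀ x → (G.ε · x) ≈ x
    ·-assoc  : ∀ g h x → ((g G.∙ h) · x) ≈ (g · (h · x))
    ·-distr  : ∀ g x y → (g · (x ∙ y)) ≈ ((g · x) ∙ (g · y))

module _ {g gℓ : Level} {G : Group g gℓ} where
  private module G = Group G

  TrivialAction : ∀ {m mℓ} → GModule G m mℓ → Set _
  TrivialAction X = ∀ g x → (g · x) ≈ x
    where open GModule X

  FaithfulAction : ∀ {m mℓ} → GModule G m mℓ → Set _
  FaithfulAction X = ∀ g → (∀ x → (g · x) ≈ x) → g G.≈ G.ε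
    where open GModule X

  record GHom {a aℓ b bℓ} (X : GModule G a aℓ) (Y : GModule G b bℓ)
         : Set (g ⊔ a ⊔ aℓ ⊔ b ⊔ bℓ) where
    private
      module X = GModule X
      module Y = GModule Y
    field
      ⟦_⟧      : X.Carrier → Y.Carrier
      cong     : ∀ {x y} → x X.≈ y → ⟦ x ⟧ Y.≈ ⟦ y ⟧
      additive : ∀ x y → ⟦ x X.∙ y ⟧ Y.≈ (⟦ x ⟧ Y.∙ ⟦ y ⟧)
      equivar  : ∀ g x → ⟦ g X.· x ⟧ Y.≈ (g Y.· ⟦ x ⟧)

  record ShortExact {a aℓ b bℓ c cℓ}
         {X : GModule G a aℓ} {Y : GModule G b bℓ} {Z : GModule G c cℓ}
         (i : GHom X Y) (p : GHom Y Z) : Set (a ⊔ aℓ ⊔ b ⊔ bℓ ⊔ c ⊔ cℓ) where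
    private
      module X = GModule X
      module Y = GModule Y
      module Z = GModule Z
      module i = GHom i
      module p = GHom p
    field
      i-injective  : ∀ x x′ → i.⟦ x ⟧ Y.≈ i.⟦ x′ ⟧ → x X.≈ x′
      ker⊆im       : ∀ y → p.⟦ y ⟧ Z.≈ Z.ε → ∃ λ x → i.⟦ x ⟧ Y.≈ y
      im⊆ker       : ∀ x → p.⟦ i.⟦ x ⟧ ⟧ Z.≈ Z.ε
      p-surjective : ∀ z → ∃ λ y → p.⟦ y ⟧ Z.≈ z

HasCard : ∀ {m mℓ} (M : AbelianGroup m mℓ) → ℕ → Set (m ⊔ mℓ)
HasCard M n = Inverse (AbelianGroup.setoid M) (≡.setoid (Fin n))

HasCardG : ∀ {g gℓ} (G : Group g gℓ) → ℕ → Set (g ⊔ gℓ)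
HasCardG G n = Inverse (Group.setoid G) (≡.setoid (Fin n))

module _ {m mℓ} (M : AbelianGroup m mℓ) where
  open AbelianGroup M

  natMul : ℕ → Carrier → Carrier
  natMul zero    x = ε
  natMul (suc n) x = x ∙ natMul n x

  intMul : ℤ → Carrier → Carrier
  intMul (+ n)     x = natMul n x
  intMul -[1+ n ]  x = (natMul (suc n) x) ⁻¹

  sumFin : ∀ k → (Fin k → Carrier) → Carrier
  sumFin zero    f = ε
  sumFin (suc k) f = f Fin.zero ∙ sumFin k (λ i → f (Fin.suc i))

  GeneratedBy : ∀ k → (Fin k → Carrier) → Set (m ⊔ mℓ)
  GeneratedBy k c = ∀ x → ∃ λ (n : Fin k → ℤ) → x ≈ sumFin k (λ i → intMul (n i) (c i))

{-# OPTIONS --safe #-}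
module Submission where

-- The map δ g x = g · x − x takes values in ι A, because G acts trivially on C, and
-- satisfies δ (g h) = δ g + δ h, because G acts trivially on A.  As B is generated by
-- ι A (killed by δ g) and lifts b₁ … b_k of the generators of C, δ g is determined by
-- the values δ g bⱼ ∈ A, so g ↦ (δ g bⱼ)ⱼ is a homomorphism G → Aᵏ, injective since B
-- is faithful.  Lagrange's theorem for its image gives #G ∣ (#A)ᵏ.  Membership in the
-- image is decidable only classically, hence the double negation: under it we may
-- decide membership in each of the finitely many points of Aᵏ and count.

open import Defs
open import Level using (_⊔_)
open import Algebra.Bundles using (Group; AbelianGroup)
import Algebra.Construct.Pointwise as Pointwise
open import Algebra.Morphism.Structures using (module MagmaMorphisms)
open MagmaMorphisms using (IsMagmaMonomorphism)
import Algebra.Properties.AbelianGroup as AbelianGroupProperties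
import Algebra.Properties.CommutativeSemigroup as CommutativeSemigroupProperties
import Algebra.Properties.Group as GroupProperties
import Algebra.Properties.Loop as LoopProperties
open import Data.Bool using (Bool; true; false; T; not; _∧_)
open import Data.Bool.Properties using (T-≡; T-irrelevant)
open import Data.Empty using (⊥-elim)
open import Data.Fin using (Fin; zero; suc; combine; funToFin; finToFun)
import Data.Fin.Properties as Fin
open import Data.Fin.Properties using (funToFin-finToFin; finToFun-funToFin; sequence)
open import Data.Fin.Permutation using (Permutation′; _⟨$⟩ʳ_; permutation)
import Data.Integer as ℤ
open import Data.Nat as ℕ using (ℕ; zero; suc; _+_; _^_; _≤_; _<_; z<s)
open import Data.Nat.Properties as ℕ using (+-0-commutativeMonoid)
open import Data.Nat.Divisibility using (_∣_; _∣0; ∣-refl; ∣m∣n⇒∣m+n)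
open import Data.Product using (Σ; ∃; ∃₂; _×_; _,_; proj₁; proj₂)
open import Effect.Monad using (RawMonad)
open import Function using (_∘_; Equivalence; Inverse)
open import Relation.Binary.PropositionalEquality
  using (_≡_; _≗_; refl; sym; trans; cong; cong₂; subst)
import Relation.Binary.Reasoning.Setoid as ≈-Reasoning
open import Relation.Nullary using (¬_; Dec; yes; no)
open import Relation.Nullary.Decidable using (isYes; toWitness; fromWitness; ¬¬-excluded-middle)
open import Relation.Nullary.Negation using (¬¬-map; ¬¬-Monad)
open import Algebra.Properties.CommutativeMonoid.Sum +-0-commutativeMonoid
  using (sum; sum-cong-≗; sum-permute; ∑-distrib-+)

private
  variable
    n : ℕ

T-∧-not⁻ : ∀ {a b} → T (a ∧ not b) → T a × ¬ T b
T-∧-not⁻ {true} {false} _ = _ , λ ()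

T-∧-not⁺ : ∀ {a b} → T a → ¬ T b → T (a ∧ not b)
T-∧-not⁺ {true} {false} _ _  = _
T-∧-not⁺ {true} {true}  _ ¬b = ¬b _

indicator : Bool → ℕ
indicator false = 0
indicator true  = 1

count : (Fin n → Bool) → ℕ
count P = sum (indicator ∘ P)

count-≗ : {P Q : Fin n → Bool} → P ≗ Q → count P ≡ count Q
count-≗ P≗Q = sum-cong-≗ (cong indicator ∘ P≗Q)

count-permute : (P : Fin n → Bool) (π : Permutation′ n) → count (P ∘ (π ⟨$⟩ʳ_)) ≡ count P
count-permute P π = sym (sum-permute (indicator ∘ P) π)

count-true : count (λ (_ : Fin n) → true) ≡ n
count-true {zero}  = refl
count-true {suc n} = cong suc (count-true {n})

count-split : (P Q : Fin n → Bool) →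
              count P ≡ count (λ x → P x ∧ not (Q x)) + count (λ x → P x ∧ Q x)
count-split P Q = trans (sum-cong-≗ (λ x → indicator-split (P x) (Q x)))
                        (∑-distrib-+ (indicator ∘ λ x → P x ∧ not (Q x)) (indicator ∘ λ x → P x ∧ Q x))
  where
  indicator-split : ∀ b c → indicator b ≡ indicator (b ∧ not c) + indicator (b ∧ c)
  indicator-split false c     = refl
  indicator-split true  false = refl
  indicator-split true  true  = refl

count-pos : (P : Fin n → Bool) {x : Fin n} → T (P x) → 0 < count P
count-pos P {zero} Px with P zero
... | true = z<s
count-pos P {suc x} Px = ℕ.<-≤-trans (count-pos (P ∘ suc) Px) (ℕ.m≤n+m _ (indicator (P zero)))

count-witness : (P : Fin n → Bool) → 0 < count P → ∃ λ x → T (P x)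
count-witness {suc n} P pos with P zero in eq
... | true  = zero , Equivalence.from T-≡ eq
... | false = let x , Px = count-witness (P ∘ suc) pos in suc x , Px

module _ (R : Fin n → Fin n → Bool)
         (R-refl : ∀ x → T (R x x))
         (R-sym : ∀ {x y} → T (R x y) → T (R y x))
         (R-trans : ∀ {x y z} → T (R x y) → T (R y z) → T (R x z))
         {m : ℕ} (class-size : ∀ x → count (R x) ≡ m) where

  private
    Saturated : (Fin n → Bool) → Set
    Saturated S = ∀ {x y} → T (S x) → T (R x y) → T (S y)

    withoutClass : Fin n → (Fin n → Bool) → Fin n → Bool
    withoutClass x S y = S y ∧ not (R x y)

    withoutClass-saturated : ∀ {S} x → Saturated S → Saturated (withoutClass x S)
    withoutClass-saturated x sat S′y Ryz =
      let Sy , ¬Rxy = T-∧-not⁻ S′y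
      in T-∧-not⁺ (sat Sy Ryz) (λ Rxz → ¬Rxy (R-trans Rxz (R-sym Ryz)))

    count-withoutClass : ∀ {S x} → Saturated S → T (S x) → count S ≡ count (withoutClass x S) + m
    count-withoutClass {S} {x} sat Sx =
      trans (count-split S (R x)) (cong (count (withoutClass x S) +_)
        (trans (count-≗ (λ y → absorb (S y) (R x y) (sat Sx))) (class-size x)))
      where
      absorb : ∀ a b → (T b → T a) → a ∧ b ≡ b
      absorb true  b     _ = refl
      absorb false true  f = ⊥-elim (f _)
      absorb false false _ = refl

    m∣count : ∀ bound S → Saturated S → count S ≤ bound → m ∣ count S
    m∣count bound S sat _ with count S ℕ.≟ 0
    ... | yes ≡0 = subst (m ∣_) (sym ≡0) (m ∣0)
    m∣count zero S sat ≤0 | no ≢0 = ⊥-elim (≢0 (ℕ.n≤0⇒n≡0 ≤0))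
    m∣count (suc bound) S sat ≤bound | no ≢0 =
      subst (m ∣_) (sym split) (∣m∣n⇒∣m+n (m∣count bound S′ (withoutClass-saturated x sat) S′≤bound) ∣-refl)
      where
      x = proj₁ (count-witness S (ℕ.n≢0⇒n>0 ≢0))
      S′ = withoutClass x S
      split : count S ≡ count S′ + m
      split = count-withoutClass sat (proj₂ (count-witness S (ℕ.n≢0⇒n>0 ≢0)))
      m>0 : 0 < m
      m>0 = subst (0 <_) (class-size x) (count-pos (R x) (R-refl x))
      S′≤bound : count S′ ≤ bound
      S′≤bound = ℕ.s≤s⁻¹ (ℕ.<-≤-trans (ℕ.m<m+n (count S′) m>0) (subst (_≤ suc bound) split ≤bound))

  class-size∣n : m ∣ n
  class-size∣n = subst (m ∣_) count-true (m∣count n (λ _ → true) (λ _ _ → _) (ℕ.≤-reflexive count-true))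

private
  extend : ∀ b {c} → (Fin c → Fin n) → Fin (indicator b + c) → Fin (suc n)
  extend true  f zero    = zero
  extend true  f (suc j) = suc (f j)
  extend false f j       = suc (f j)

  first : ∀ b {c} → T b → Fin (indicator b + c)
  first true _ = zero

  shift : ∀ b {c} → Fin c → Fin (indicator b + c)
  shift true  j = suc j
  shift false j = j

select : (P : Fin n → Bool) → Fin (count P) → Fin n
select {suc n} P = extend (P zero) (select (P ∘ suc))

rank : (P : Fin n → Bool) (x : Fin n) → T (P x) → Fin (count P)
rank P zero    Px = first (P zero) Px
rank P (suc x) Px = shift (P zero) (rank (P ∘ suc) x Px)

select-T : (P : Fin n → Bool) (j : Fin (count P)) → T (P (select P j))
select-T {suc n} P j with P zero in eq
select-T {suc n} P zero    | true  = Equivalence.from T-≡ eq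
select-T {suc n} P (suc j) | true  = select-T (P ∘ suc) j
select-T {suc n} P j       | false = select-T (P ∘ suc) j

select-injective : (P : Fin n → Bool) {i j : Fin (count P)} → select P i ≡ select P j → i ≡ j
select-injective {suc n} P {i} {j} eq with P zero
select-injective {suc n} P {zero}  {zero}  eq | true  = refl
select-injective {suc n} P {suc i} {suc j} eq | true  = cong suc (select-injective (P ∘ suc) (Fin.suc-injective eq))
select-injective {suc n} P {i}     {j}     eq | false = select-injective (P ∘ suc) (Fin.suc-injective eq)

select-rank : (P : Fin n → Bool) (x : Fin n) (Px : T (P x)) → select P (rank P x Px) ≡ x
select-rank {suc n} P zero Px with P zero
... | true = refl
select-rank {suc n} P (suc x) Px with P zero
... | true  = cong suc (select-rank (P ∘ suc) x Px)
... | false = cong suc (select-rank (P ∘ suc) x Px)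

rank-select : (P : Fin n → Bool) (j : Fin (count P)) (Px : T (P (select P j))) → rank P (select P j) Px ≡ j
rank-select P j Px = select-injective P (select-rank P (select P j) Px)

rank-cong : (P : Fin n → Bool) {x y : Fin n} (Px : T (P x)) (Py : T (P y)) → x ≡ y → rank P x Px ≡ rank P y Py
rank-cong P Px Py refl = cong (rank P _) (T-irrelevant Px Py)

funToFin-cong : ∀ {k} {f g : Fin k → Fin n} → f ≗ g → funToFin f ≡ funToFin g
funToFin-cong {k = zero}  _   = refl
funToFin-cong {k = suc k} f≗g = cong₂ combine (f≗g zero) (funToFin-cong (f≗g ∘ suc))

HasCard-^ : ∀ {a ℓ} (M : AbelianGroup a ℓ) k → HasCard M n → HasCard (Pointwise.abelianGroup (Fin k) M) (n ^ k)
HasCard-^ M k card = record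
  { to        = λ f → funToFin (to ∘ f)
  ; from      = λ x j → from (finToFun x j)
  ; to-cong   = λ f≈g → funToFin-cong (λ j → to-cong (f≈g j))
  ; from-cong = λ { refl j → M.refl }
  ; inverse   = (λ {x} y≈ → trans (funToFin-cong (λ j → trans (to-cong (y≈ j)) (strictlyInverseˡ (finToFun x j))))
                                   (funToFin-finToFin {k} x))
              , (λ { {x} refl j → M.trans (from-cong (finToFun-funToFin (to ∘ x) j)) (strictlyInverseʳ (x j)) })
  }
  where
  module M = AbelianGroup M
  open Inverse card

module GroupHomomorphism {g gℓ h hℓ} (X : Group g gℓ) (Y : Group h hℓ)
  (f : Group.Carrier X → Group.Carrier Y)
  (f-cong : ∀ {x y} → Group._≈_ X x y → Group._≈_ Y (f x) (f y))
  (f-homo : ∀ x y → Group._≈_ Y (f (Group._∙_ X x y)) (Group._∙_ Y (f x) (f y))) where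

  private
    module X = Group X
    module Y = Group Y
  open Y using (_≈_; _∙_; _⁻¹; _//_; ε)

  f-ε : f X.ε ≈ ε
  f-ε = identityʳ-unique (f X.ε) (f X.ε) (Y.trans (Y.sym (f-homo X.ε X.ε)) (f-cong (X.identityˡ X.ε)))
    where open LoopProperties (GroupProperties.loop Y)

  f-⁻¹ : ∀ x → f (x X.⁻¹) ≈ f x ⁻¹
  f-⁻¹ x = GroupProperties.inverseʳ-unique Y (f x) (f (x X.⁻¹))
             (Y.trans (Y.sym (f-homo x (x X.⁻¹))) (Y.trans (f-cong (X.inverseʳ x)) f-ε))

  f-// : ∀ x y → f (x X.// y) ≈ f x // f y
  f-// x y = Y.trans (f-homo x (y X.⁻¹)) (Y.∙-congˡ (f-⁻¹ y))

module Multiples {m mℓ} (M : AbelianGroup m mℓ) where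
  private module M = AbelianGroup M
  open M using (Carrier; _≈_; ∙-cong; ⁻¹-cong)

  natMul-cong : ∀ n {x y} → x ≈ y → natMul M n x ≈ natMul M n y
  natMul-cong zero    x≈y = M.refl
  natMul-cong (suc n) x≈y = ∙-cong x≈y (natMul-cong n x≈y)

  intMul-cong : ∀ z {x y} → x ≈ y → intMul M z x ≈ intMul M z y
  intMul-cong (ℤ.+ n)    x≈y = natMul-cong n x≈y
  intMul-cong ℤ.-[1+ n ] x≈y = ⁻¹-cong (natMul-cong (suc n) x≈y)

  sumFin-cong : ∀ k {u v : Fin k → Carrier} → (∀ j → u j ≈ v j) → sumFin M k u ≈ sumFin M k v
  sumFin-cong zero    u≈v = M.refl
  sumFin-cong (suc k) u≈v = ∙-cong (u≈v zero) (sumFin-cong k (u≈v ∘ suc))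

module AdditiveMap {x xℓ y yℓ} (X : AbelianGroup x xℓ) (Y : AbelianGroup y yℓ)
  (f : AbelianGroup.Carrier X → AbelianGroup.Carrier Y)
  (f-cong : ∀ {a b} → AbelianGroup._≈_ X a b → AbelianGroup._≈_ Y (f a) (f b))
  (f-homo : ∀ a b → AbelianGroup._≈_ Y (f (AbelianGroup._∙_ X a b)) (AbelianGroup._∙_ Y (f a) (f b))) where

  private
    module X = AbelianGroup X
    module Y = AbelianGroup Y
  open Y using (_≈_)
  open GroupHomomorphism X.group Y.group f f-cong f-homo public

  f-natMul : ∀ n a → f (natMul X n a) ≈ natMul Y n (f a)
  f-natMul zero    a = f-ε
  f-natMul (suc n) a = Y.trans (f-homo a _) (Y.∙-congˡ (f-natMul n a))

  f-intMul : ∀ z a → f (intMul X z a) ≈ intMul Y z (f a)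
  f-intMul (ℤ.+ n)    a = f-natMul n a
  f-intMul ℤ.-[1+ n ] a = Y.trans (f-⁻¹ _) (Y.⁻¹-cong (f-natMul (suc n) a))

  f-sumFin : ∀ k (u : Fin k → X.Carrier) → f (sumFin X k u) ≈ sumFin Y k (f ∘ u)
  f-sumFin zero    u = f-ε
  f-sumFin (suc k) u = Y.trans (f-homo _ _) (Y.∙-congˡ (f-sumFin k (u ∘ suc)))

module _ {ℓ₁ ℓ₂ ℓ₃ ℓ₄} (G : Group ℓ₁ ℓ₂) (V : Group ℓ₃ ℓ₄) {N : ℕ} (cardV : HasCardG V N)
         {f : Group.Carrier G → Group.Carrier V}
         (mono : IsMagmaMonomorphism (Group.rawMagma G) (Group.rawMagma V) f) where

  private
    module G = Group G
    module V = Group V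
    open IsMagmaMonomorphism mono using (⟦⟧-cong; homo; injective)
    open GroupHomomorphism G V f ⟦⟧-cong homo using (f-ε; f-⁻¹)
    open Inverse cardV renaming (to to code; from to decode)

    InImage : V.Carrier → Set (ℓ₁ ⊔ ℓ₄)
    InImage x = ∃ λ g → f g V.≈ x

    module DecidableImage (inImage? : ∀ w → Dec (InImage (decode w))) where

      inImage : Fin N → Bool
      inImage = isYes ∘ inImage?

      inImage⁺ : ∀ {x} → InImage x → T (inImage (code x))
      inImage⁺ (g , fg≈x) = fromWitness (g , V.trans fg≈x (V.sym (strictlyInverseʳ _)))

      inImage⁻ : ∀ {x} → T (inImage (code x)) → InImage x
      inImage⁻ t = let g , fg≈ = toWitness t in g , V.trans fg≈ (strictlyInverseʳ _)

      _∼_ : Fin N → Fin N → Bool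
      u ∼ w = inImage (code (decode w V.// decode u))

      ∼-refl : ∀ w → T (w ∼ w)
      ∼-refl w = inImage⁺ (G.ε , V.trans f-ε (V.sym (V.inverseʳ (decode w))))

      ∼-sym : ∀ {u w} → T (u ∼ w) → T (w ∼ u)
      ∼-sym {u} {w} t = let g , fg≈ = inImage⁻ t in
        inImage⁺ (g G.⁻¹ , V.trans (f-⁻¹ g) (V.trans (V.⁻¹-cong fg≈)
                                           (GroupProperties.⁻¹-anti-homo-// V (decode w) (decode u))))

      ∼-trans : ∀ {u v w} → T (u ∼ v) → T (v ∼ w) → T (u ∼ w)
      ∼-trans {u} {v} {w} s t = let g , fg≈ = inImage⁻ s ; h , fh≈ = inImage⁻ t in
        inImage⁺ (h G.∙ g , V.trans (homo h g) (V.trans (V.∙-cong fh≈ fg≈) (//-chain (decode w) (decode v) (decode u))))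
        where
        //-chain : ∀ x y z → (x V.// y) V.∙ (y V.// z) V.≈ x V.// z
        //-chain x y z = V.trans (V.sym (V.assoc (x V.// y) y (z V.⁻¹)))
                                 (V.∙-congʳ (GroupProperties.//-rightDividesˡ V y x))

      translate : V.Carrier → Fin N → Fin N
      translate a w = code (decode w V.∙ a)

      translate-cancel : ∀ {a b} → a V.∙ b V.≈ V.ε → ∀ w → translate b (translate a w) ≡ w
      translate-cancel {a} {b} ab≈ε w = trans (to-cong (begin
        decode (code (decode w V.∙ a)) V.∙ b ≈⟨ V.∙-congʳ (strictlyInverseʳ _) ⟩
        (decode w V.∙ a) V.∙ b               ≈⟨ V.assoc _ a b ⟩
        decode w V.∙ (a V.∙ b)               ≈⟨ V.∙-congˡ ab≈ε ⟩
        decode w V.∙ V.ε                     ≈⟨ V.identityʳ _ ⟩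
        decode w                             ∎)) (strictlyInverseˡ w)
        where open ≈-Reasoning V.setoid

      class-size : ∀ u → count (u ∼_) ≡ count inImage
      class-size u = count-permute inImage
        (permutation (translate (x V.⁻¹)) (translate x) (translate-cancel (V.inverseʳ x)) (translate-cancel (V.inverseˡ x)))
        where x = decode u

      order : ℕ
      order = count inImage

      order∣N : order ∣ N
      order∣N = class-size∣n _∼_ ∼-refl ∼-sym ∼-trans class-size

      preimage : ∀ j → InImage (decode (select inImage j))
      preimage j = toWitness (select-T inImage j)

      toFin : G.Carrier → Fin order
      toFin g = rank inImage (code (f g)) (inImage⁺ (g , V.refl))

      fromFin : Fin order → G.Carrier
      fromFin j = proj₁ (preimage j)

      toFin-fromFin : ∀ j → toFin (fromFin j) ≡ j
      toFin-fromFin j =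
        trans (rank-cong inImage _ (select-T inImage j) (trans (to-cong (proj₂ (preimage j))) (strictlyInverseˡ _)))
              (rank-select inImage j _)

      fromFin-toFin : ∀ g → fromFin (toFin g) G.≈ g
      fromFin-toFin g = injective (V.trans (proj₂ (preimage (toFin g)))
        (V.trans (from-cong (select-rank inImage (code (f g)) _)) (strictlyInverseʳ (f g))))

      G↔order : HasCardG G order
      G↔order = record
        { to        = toFin
        ; from      = fromFin
        ; to-cong   = λ g≈h → rank-cong inImage _ _ (to-cong (⟦⟧-cong g≈h))
        ; from-cong = λ { refl → G.refl }
        ; inverse   = (λ {j} g≈ → trans (rank-cong inImage _ _ (to-cong (⟦⟧-cong g≈))) (toFin-fromFin j))
                    , (λ { refl → fromFin-toFin _ })
        }

  lagrange : ¬ ¬ Σ ℕ λ m → HasCardG G m × m ∣ N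
  lagrange = ¬¬-map (λ inImage? → let open DecidableImage inImage? in order , G↔order , order∣N)
                    (sequence (RawMonad.rawApplicative ¬¬-Monad) (λ _ → ¬¬-excluded-middle))

faithful⇒·-injective : ∀ {ℓ₁ ℓ₂ ℓ₃ ℓ₄} {G : Group ℓ₁ ℓ₂} (X : GModule G ℓ₃ ℓ₄) → FaithfulAction X →
                       ∀ {g h} → (∀ x → GModule._≈_ X (GModule._·_ X g x) (GModule._·_ X h x)) → Group._≈_ G g h
faithful⇒·-injective {G = G} X faithful {g} {h} g·≈h· =
  G.trans (GroupProperties.inverseʳ-unique G (h G.⁻¹) g (faithful (h G.⁻¹ G.∙ g) h⁻¹g-fixes))
          (GroupProperties.⁻¹-involutive G h)
  where
  module G = Group G
  module X = GModule X
  open X using (_·_; _≈_; ·-assoc; ·-cong; ·-ident)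
  open ≈-Reasoning X.setoid
  h⁻¹g-fixes : ∀ x → (h G.⁻¹ G.∙ g) · x ≈ x
  h⁻¹g-fixes x = begin
    (h G.⁻¹ G.∙ g) · x   ≈⟨ ·-assoc (h G.⁻¹) g x ⟩
    h G.⁻¹ · (g · x)     ≈⟨ ·-cong G.refl (g·≈h· x) ⟩
    h G.⁻¹ · (h · x)     ≈⟨ X.sym (·-assoc (h G.⁻¹) h x) ⟩
    (h G.⁻¹ G.∙ h) · x   ≈⟨ ·-cong (G.inverseˡ h) X.refl ⟩
    G.ε · x              ≈⟨ ·-ident x ⟩
    x                    ∎

module ShortExactSequence {ℓ₁ ℓ₂ ℓ₃ ℓ₄ ℓ₅ ℓ₆ ℓ₇ ℓ₈} {G : Group ℓ₁ ℓ₂}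
  {A : GModule G ℓ₃ ℓ₄} {B : GModule G ℓ₅ ℓ₆} {C : GModule G ℓ₇ ℓ₈}
  (trivA : TrivialAction A) (trivC : TrivialAction C)
  {i : GHom A B} {p : GHom B C} (exact : ShortExact i p) where

  private
    module G = Group G
    module A = GModule A
    module B = GModule B
    module C = GModule C
    open ShortExact exact
    open GHom i using () renaming (⟦_⟧ to ι; cong to ι-cong; additive to ι-homo; equivar to ι-equivar)
    open GHom p using () renaming (⟦_⟧ to π; cong to π-cong; additive to π-homo; equivar to π-equivar)
    module π = AdditiveMap B.M C.M π π-cong π-homo
    module BMultiples = Multiples B.M
    module CMultiples = Multiples C.M
    open B using (_≈_; _∙_; _⁻¹; _-_; _·_; ε)
    open ≈-Reasoning B.setoid

  δ : G.Carrier → B.Carrier → B.Carrier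
  δ g x = g · x - x

  δ-cong : ∀ {g h x y} → g G.≈ h → x ≈ y → δ g x ≈ δ h y
  δ-cong g≈h x≈y = B.∙-cong (B.·-cong g≈h x≈y) (B.⁻¹-cong x≈y)

  δ-homo : ∀ g x y → δ g (x ∙ y) ≈ δ g x ∙ δ g y
  δ-homo g x y = begin
    g · (x ∙ y) - (x ∙ y)                ≈⟨ B.∙-cong (B.·-distr g x y) (B.sym (AbelianGroupProperties.⁻¹-∙-comm B.M x y)) ⟩
    ((g · x) ∙ (g · y)) ∙ (x ⁻¹ ∙ y ⁻¹)  ≈⟨ CommutativeSemigroupProperties.interchange B.commutativeSemigroup (g · x) (g · y) (x ⁻¹) (y ⁻¹) ⟩
    (g · x - x) ∙ (g · y - y)            ∎

  ·-fixes-ι : ∀ g a → g · ι a ≈ ι a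
  ·-fixes-ι g a = B.trans (B.sym (ι-equivar g a)) (ι-cong (trivA g a))

  δ-ι : ∀ g a → δ g (ι a) ≈ ε
  δ-ι g a = B.trans (B.∙-congʳ (·-fixes-ι g a)) (B.inverseʳ (ι a))

  δ∈ι : ∀ g x → ∃ λ a → ι a ≈ δ g x
  δ∈ι g x = ker⊆im (δ g x) (C.trans (π.f-// (g · x) x)
                     (C.trans (C.∙-congʳ (C.trans (π-equivar g x) (trivC g (π x)))) (C.inverseʳ (π x))))

  ·-fixes-δ : ∀ g h x → g · δ h x ≈ δ h x
  ·-fixes-δ g h x = let a , ιa≈ = δ∈ι h x in
    B.trans (B.·-cong G.refl (B.sym ιa≈)) (B.trans (·-fixes-ι g a) ιa≈)

  δ-cocycle : ∀ g h x → δ (g G.∙ h) x ≈ δ h x ∙ δ g x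
  δ-cocycle g h x = begin
    (g G.∙ h) · x - x          ≈⟨ B.∙-congʳ (B.·-assoc g h x) ⟩
    g · (h · x) - x            ≈⟨ B.∙-congʳ (B.·-cong G.refl (B.sym (GroupProperties.//-rightDividesˡ B.group x (h · x)))) ⟩
    g · (δ h x ∙ x) - x        ≈⟨ B.∙-congʳ (B.·-distr g (δ h x) x) ⟩
    ((g · δ h x) ∙ (g · x)) - x  ≈⟨ B.∙-congʳ (B.∙-congʳ (·-fixes-δ g h x)) ⟩
    (δ h x ∙ (g · x)) - x      ≈⟨ B.assoc (δ h x) (g · x) (x ⁻¹) ⟩
    δ h x ∙ δ g x              ∎

  module _ {k} {gens : Fin k → C.Carrier} (generated : GeneratedBy C.M k gens) where

    lift : Fin k → B.Carrier
    lift j = proj₁ (p-surjective (gens j))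

    combination : (Fin k → ℤ.ℤ) → (Fin k → B.Carrier) → B.Carrier
    combination n v = sumFin B.M k (λ j → intMul B.M (n j) (v j))

    decompose : ∀ x → ∃₂ λ a n → x ≈ ι a ∙ combination n lift
    decompose x = a , coeffs , (begin
      x                 ≈⟨ GroupProperties.//-rightDividesˡ B.group s x ⟨
      (x - s) ∙ s       ≈⟨ B.∙-congʳ ιa≈x-s ⟨
      ι a ∙ s           ∎)
      where
      coeffs = proj₁ (generated (π x))
      s = combination coeffs lift
      πs≈πx : π s C.≈ π x
      πs≈πx = C.trans (π.f-sumFin k _)
              (C.trans (CMultiples.sumFin-cong k (λ j → C.trans (π.f-intMul (coeffs j) (lift j))
                                                     (CMultiples.intMul-cong (coeffs j) (proj₂ (p-surjective (gens j))))))
                       (C.sym (proj₂ (generated (π x)))))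
      x-s∈ker : π (x - s) C.≈ C.ε
      x-s∈ker = C.trans (π.f-// x s) (C.trans (C.∙-congˡ (C.⁻¹-cong πs≈πx)) (C.inverseʳ (π x)))
      a = proj₁ (ker⊆im (x - s) x-s∈ker)
      ιa≈x-s = proj₂ (ker⊆im (x - s) x-s∈ker)

    δ-on-decomposition : ∀ g a coeffs → δ g (ι a ∙ combination coeffs lift) ≈ combination coeffs (δ g ∘ lift)
    δ-on-decomposition g a coeffs = begin
      δ g (ι a ∙ combination coeffs lift)             ≈⟨ δ-homo g (ι a) _ ⟩
      δ g (ι a) ∙ δ g (combination coeffs lift)       ≈⟨ B.∙-congʳ (δ-ι g a) ⟩
      ε ∙ δ g (combination coeffs lift)               ≈⟨ B.identityˡ _ ⟩
      δ g (combination coeffs lift)                   ≈⟨ δg.f-sumFin k _ ⟩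
      sumFin B.M k (λ j → δ g (intMul B.M (coeffs j) (lift j)))
        ≈⟨ BMultiples.sumFin-cong k (λ j → δg.f-intMul (coeffs j) (lift j)) ⟩
      combination coeffs (δ g ∘ lift)                 ∎
      where module δg = AdditiveMap B.M B.M (δ g) (δ-cong G.refl) (δ-homo g)

    δ-determined-by-lifts : ∀ {g h} → (∀ j → δ g (lift j) ≈ δ h (lift j)) → ∀ x → δ g x ≈ δ h x
    δ-determined-by-lifts {g} {h} agree x = begin
      δ g x                                  ≈⟨ δ-cong G.refl x≈ ⟩
      δ g (ι a ∙ combination coeffs lift)    ≈⟨ δ-on-decomposition g a coeffs ⟩
      combination coeffs (δ g ∘ lift)        ≈⟨ BMultiples.sumFin-cong k (λ j → BMultiples.intMul-cong (coeffs j) (agree j)) ⟩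
      combination coeffs (δ h ∘ lift)        ≈⟨ δ-on-decomposition h a coeffs ⟨
      δ h (ι a ∙ combination coeffs lift)    ≈⟨ δ-cong G.refl x≈ ⟨
      δ h x                                  ∎
      where
      a = proj₁ (decompose x)
      coeffs = proj₁ (proj₂ (decompose x))
      x≈ = proj₂ (proj₂ (decompose x))

    ψ : G.Carrier → Fin k → A.Carrier
    ψ g j = proj₁ (δ∈ι g (lift j))

    ι-ψ : ∀ g j → ι (ψ g j) ≈ δ g (lift j)
    ι-ψ g j = proj₂ (δ∈ι g (lift j))

    ψ-cong : ∀ {g h} → g G.≈ h → ∀ j → ψ g j A.≈ ψ h j
    ψ-cong g≈h j = i-injective _ _ (B.trans (ι-ψ _ j) (B.trans (δ-cong g≈h B.refl) (B.sym (ι-ψ _ j))))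

    ψ-homo : ∀ g h j → ψ (g G.∙ h) j A.≈ ψ g j A.∙ ψ h j
    ψ-homo g h j = i-injective _ _ (begin
      ι (ψ (g G.∙ h) j)               ≈⟨ ι-ψ (g G.∙ h) j ⟩
      δ (g G.∙ h) (lift j)            ≈⟨ δ-cocycle g h (lift j) ⟩
      δ h (lift j) ∙ δ g (lift j)     ≈⟨ B.comm _ _ ⟩
      δ g (lift j) ∙ δ h (lift j)     ≈⟨ B.∙-cong (ι-ψ g j) (ι-ψ h j) ⟨
      ι (ψ g j) ∙ ι (ψ h j)           ≈⟨ ι-homo _ _ ⟨
      ι (ψ g j A.∙ ψ h j)             ∎)

    ψ-injective : FaithfulAction B → ∀ {g h} → (∀ j → ψ g j A.≈ ψ h j) → g G.≈ h
    ψ-injective faithful {g} {h} ψg≈ψh = faithful⇒·-injective B faithful (λ x → begin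
      g · x          ≈⟨ GroupProperties.//-rightDividesˡ B.group x (g · x) ⟨
      δ g x ∙ x      ≈⟨ B.∙-congʳ (δ-determined-by-lifts agree x) ⟩
      δ h x ∙ x      ≈⟨ GroupProperties.//-rightDividesˡ B.group x (h · x) ⟩
      h · x          ∎)
      where
      agree : ∀ j → δ g (lift j) ≈ δ h (lift j)
      agree j = B.trans (B.sym (ι-ψ g j)) (B.trans (ι-cong (ψg≈ψh j)) (ι-ψ h j))

    ψ-isMagmaMonomorphism : FaithfulAction B →
      IsMagmaMonomorphism (Group.rawMagma G) (AbelianGroup.rawMagma (Pointwise.abelianGroup (Fin k) A.M)) ψ
    ψ-isMagmaMonomorphism faithful = record
      { isMagmaHomomorphism = record
        { isRelHomomorphism = record { cong = ψ-cong }
        ; homo              = ψ-homo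
        }
      ; injective = ψ-injective faithful
      }

lemma4p2 : ∀ {g gℓ a aℓ b bℓ c cℓ} (G : Group g gℓ)
           (A : GModule G a aℓ) (B : GModule G b bℓ) (C : GModule G c cℓ)
           (nA nB nC : ℕ)
           → HasCard (GModule.M A) nA → HasCard (GModule.M B) nB → HasCard (GModule.M C) nC
           → TrivialAction A → TrivialAction C → FaithfulAction B
           → (i : GHom A B) (p : GHom B C) → ShortExact i p
           → (k : ℕ) (gens : Fin k → GModule.Carrier C) → GeneratedBy (GModule.M C) k gens
           → ¬ ¬ (Σ ℕ λ m → HasCardG G m × m ∣ nA ^ k)
lemma4p2 G A B C nA _ _ cardA _ _ trivA trivC faithful i p exact k gens generated =
  lagrange G (AbelianGroup.group (Pointwise.abelianGroup (Fin k) (GModule.M A))) (HasCard-^ (GModule.M A) k cardA)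
           (ψ-isMagmaMonomorphism generated faithful)
  where open ShortExactSequence trivA trivC exact
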